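{- Let $u\in[2]^n$ be a word of length $n$ over $\{1,2\}$ with $m_1(u)\ge1$ and $m_2(u)\ge1$. If $w\in C(u)$, then $\max R_i(w)\le 2$ for $i\le 2$.
   Context: Juxtaposition denotes concatenation of words. $P(w)$ is the insertion tableau of $w$ under the Robinson–Schensted–Knuth (row-insertion) correspondence, and $C(u)=\{w : P(uw)=P(wu)\}$. $R_i(w)$ denotes the $i$th row of $P(w)$ (empty if $P(w)$ has fewer than $i$ rows; the condition $\max R_i(w)\le2$ holds vacuously for an empty row). $m_a(u)$ is the number of occurrences of the letter $a$ in $u$. -}

module Defs where

open import Data.Nat using (ℕ; zero; suc; _<?_; _⊔_)
open import Data.Nat.Properties using (_≟_)
open import Data.List using (List; []; _∷_; _++_; foldl; foldr; length; filter)
open import Data.Maybe using (Maybe; just; nothing)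
open import Data.Product using (_×_; _,_)
open import Relation.Nullary using (yes; no)

-- Words over the positive integers are lists of naturals (positivity is
-- imposed as a hypothesis in the statement). Juxtaposition = _++_.
Word : Set
Word = List ℕ

-- A tableau is a list of rows, top row first.
Tableau : Set
Tableau = List (List ℕ)

rowInsert : ℕ → List ℕ → Maybe ℕ × List ℕ
rowInsert x [] = nothing , x ∷ []
rowInsert x (y ∷ ys) with x <? y
... | yes _ = just y , x ∷ ys
... | no _ with rowInsert x ys
...   | b , r = b , y ∷ r

insertT : ℕ → Tableau → Tableau
insertT x [] = (x ∷ []) ∷ []
insertT x (r ∷ rs) with rowInsert x r
... | nothing , r' = r' ∷ rs
... | just y , r' = r' ∷ insertT y rs

P : Word → Tableau
P w = foldl (λ T x → insertT x T) [] w

C : Word → Word → Set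
C u w = P (u ++ w) Relation.Binary.PropositionalEquality.≡ P (w ++ u)
  where import Relation.Binary.PropositionalEquality

-- i-th row (1-indexed) of a tableau, empty if there is no such row.
rowOf : ℕ → Tableau → List ℕ
rowOf zero _ = []
rowOf (suc i) [] = []
rowOf (suc zero) (r ∷ rs) = r
rowOf (suc (suc i)) (r ∷ rs) = rowOf (suc i) rs

R : ℕ → Word → List ℕ
R i w = rowOf i (P w)

-- maximum of a list of naturals (0 for the empty list, so that
-- "max R_i(w) ≤ 2" holds vacuously for an empty row)
maxL : List ℕ → ℕ
maxL = foldr _⊔_ 0

m : ℕ → Word → ℕ
m a u = length (filter (_≟ a) u)

module Submission where

-- Only the first two rows of P matter, and for letters ≤ 2 they evolve on their own: appending
-- x to a word row-inserts x, while prepending x column-inserts it (row and column insertion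
-- commute), and a letter ≤ 2 never travels below row 2.  So C u w says that column inserting
-- u into the two rows of P(w), from the right, gives the same result as row inserting u.
-- Count the entries exceeding 2.  Column insertion of small letters never lowers the count in
-- row 1, nor the total count, nor the length of row 2; row insertion of 1s and 2s never raises
-- either count.  A big entry in row 1 would be bumped out of it by the 2 of u, lowering its count.
-- With row 1 ≤ 2, the total count must stay put under row insertion; if row 2 holds a big entry,
-- this forces u = 1…12…2 with row 1 of P(w) made of 1s, and row insertion merely appends u to
-- row 1.  But the last letter of u, a 2, is column inserted first and either lengthens row 2 or
-- lifts a big entry into row 1, which the remaining column insertions cannot undo.

open import Defs
open import Data.Nat using (ℕ; suc; _≤_; _<_; _≤?_; _<?_; z≤n; s≤s; z<s; _+_; _⊔_)
open import Data.Nat.Properties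
open import Data.List using (List; []; _∷_; _++_; length; foldl; foldr; [_])
open import Data.List.Properties using (foldl-++; foldr-++; ++-assoc; ++-identityʳ; filter-reject)
open import Data.List.Membership.Propositional using (_∈_)
open import Data.List.Relation.Unary.Any using (here; there)
open import Data.List.Relation.Unary.All as All using (All; []; _∷_)
open import Data.List.Relation.Unary.All.Properties using (++⁺)
open import Data.Maybe using (Maybe; just; nothing; maybe′)
open import Data.Product using (_×_; _,_; proj₁; proj₂; ∃; ∃₂)
open import Data.Sum using (_⊎_; inj₁; inj₂)
open import Function using (_∘_)
open import Data.Empty using (⊥)
open import Data.Unit using (⊤; tt)
open import Relation.Nullary using (yes; no; ¬_; contradiction)
open import Relation.Binary.PropositionalEquality hiding ([_])
open import Data.Nat.Tactic.RingSolver using (solve-∀)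
open import Algebra.Properties.CommutativeSemigroup +-commutativeSemigroup using (x∙yz≈y∙xz; x∙yz≈x∙zy)

_≤head_ : ℕ → List ℕ → Set
x ≤head [] = ⊤
x ≤head (a ∷ _) = x ≤ a

HeadBelow : ℕ → List ℕ → Set
HeadBelow z [] = ⊥
HeadBelow z (a ∷ _) = a < z

Sorted : List ℕ → Set
Sorted [] = ⊤
Sorted (a ∷ as) = a ≤head as × Sorted as

ColumnStrict : List ℕ → List ℕ → Set
ColumnStrict _ [] = ⊤
ColumnStrict [] (_ ∷ _) = ⊥
ColumnStrict (a ∷ as) (b ∷ bs) = a < b × ColumnStrict as bs

≤head-trans : ∀ {x y} r → x ≤ y → y ≤head r → x ≤head r
≤head-trans [] _ _ = tt
≤head-trans (_ ∷ _) x≤y y≤a = ≤-trans x≤y y≤a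

data RowInsert (y : ℕ) : List ℕ → Maybe ℕ → List ℕ → Set where
  append : RowInsert y [] nothing [ y ]
  bump   : ∀ {a as} → y < a → RowInsert y (a ∷ as) (just a) (y ∷ as)
  skip   : ∀ {a as mz as′} → a ≤ y → RowInsert y as mz as′ → RowInsert y (a ∷ as) mz (a ∷ as′)

rowInsert-RowInsert : ∀ y r → RowInsert y r (proj₁ (rowInsert y r)) (proj₂ (rowInsert y r))
rowInsert-RowInsert y [] = append
rowInsert-RowInsert y (a ∷ as) with y <? a
... | yes y<a = bump y<a
... | no y≮a with rowInsert y as | rowInsert-RowInsert y as
...   | _ , _ | h = skip (≮⇒≥ y≮a) h

RowInsert⇒rowInsert : ∀ {y r mz r′} → RowInsert y r mz r′ → rowInsert y r ≡ (mz , r′)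
RowInsert⇒rowInsert append = refl
RowInsert⇒rowInsert {y} (bump {a} y<a) with y <? a
... | yes _ = refl
... | no y≮a = contradiction y<a y≮a
RowInsert⇒rowInsert {y} (skip {a} a≤y h) with y <? a
... | yes y<a = contradiction y<a (≤⇒≯ a≤y)
... | no _ rewrite RowInsert⇒rowInsert h = refl

RowInsert-bumped-unique : ∀ {y r mz r′ mz″ r″} → RowInsert y r mz r′ → RowInsert y r mz″ r″ → mz ≡ mz″
RowInsert-bumped-unique h h′ = cong proj₁ (trans (sym (RowInsert⇒rowInsert h)) (RowInsert⇒rowInsert h′))

RowInsert-skip-bumped : ∀ {x y r mz r′ mz″ r″} → x ≤ y → RowInsert y r mz r′ → RowInsert y (x ∷ r) mz″ r″ →
  mz″ ≡ mz
RowInsert-skip-bumped x≤y h (bump y<x) = contradiction y<x (≤⇒≯ x≤y)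
RowInsert-skip-bumped x≤y h (skip _ h′) = RowInsert-bumped-unique h′ h

RowInsert-skip-inv : ∀ {x y r mz R} → x ≤ y → RowInsert y (x ∷ r) mz R → ∃ λ r′ → RowInsert y r mz r′
RowInsert-skip-inv x≤y (bump y<x) = contradiction y<x (≤⇒≯ x≤y)
RowInsert-skip-inv x≤y (skip _ h) = _ , h

RowInsert-bumped> : ∀ {y r z r′} → RowInsert y r (just z) r′ → y < z
RowInsert-bumped> (bump y<a) = y<a
RowInsert-bumped> (skip _ h) = RowInsert-bumped> h

RowInsert-≤head : ∀ {x y r mz r′} → RowInsert y r mz r′ → x ≤head r → x ≤ y → x ≤head r′
RowInsert-≤head append _ x≤y = x≤y
RowInsert-≤head (bump _) _ x≤y = x≤y
RowInsert-≤head (skip _ _) x≤a _ = x≤a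

RowInsert-sorted : ∀ {y r mz r′} → RowInsert y r mz r′ → Sorted r → Sorted r′
RowInsert-sorted append _ = tt , tt
RowInsert-sorted (bump {as = as} y<a) (a≤as , as↑) = ≤head-trans as (<⇒≤ y<a) a≤as , as↑
RowInsert-sorted (skip a≤y h) (a≤as , as↑) = RowInsert-≤head h a≤as a≤y , RowInsert-sorted h as↑

RowInsert-headBelow : ∀ {y r z r′} → RowInsert y r (just z) r′ → HeadBelow z r′
RowInsert-headBelow (bump y<a) = y<a
RowInsert-headBelow (skip a≤y h) = ≤-<-trans a≤y (RowInsert-bumped> h)

RowInsert-columnStrict : ∀ {y r mz r′} s → RowInsert y r mz r′ → ColumnStrict r s → ColumnStrict r′ s
RowInsert-columnStrict [] _ _ = tt
RowInsert-columnStrict (_ ∷ _) append ()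
RowInsert-columnStrict (_ ∷ _) (bump y<a) (a<b , st) = <-trans y<a a<b , st
RowInsert-columnStrict (_ ∷ s) (skip _ h) (a<b , st) = a<b , RowInsert-columnStrict s h st

RowInsert-maxL : ∀ {y r mz r′} → RowInsert y r mz r′ → maxL r′ ≤ y ⊔ maxL r
RowInsert-maxL append = ≤-refl
RowInsert-maxL {y} (bump {a} {as} _) = ⊔-monoʳ-≤ y (m≤n⊔m a (maxL as))
RowInsert-maxL {y} (skip {a} {as} _ h) =
  ⊔-lub (≤-trans (m≤m⊔n a (maxL as)) (m≤n⊔m y _))
        (≤-trans (RowInsert-maxL h) (⊔-monoʳ-≤ y (m≤n⊔m a (maxL as))))

RowInsert-nothing⇒maxL≤ : ∀ {y r r′} → RowInsert y r nothing r′ → maxL r ≤ y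
RowInsert-nothing⇒maxL≤ append = z≤n
RowInsert-nothing⇒maxL≤ (skip a≤y h) = ⊔-lub a≤y (RowInsert-nothing⇒maxL≤ h)

RowInsert-bumped≤maxL : ∀ {y r z r′} → RowInsert y r (just z) r′ → z ≤ maxL r
RowInsert-bumped≤maxL (bump {a} {as} _) = m≤m⊔n a (maxL as)
RowInsert-bumped≤maxL (skip {a} {as} _ h) = ≤-trans (RowInsert-bumped≤maxL h) (m≤n⊔m a (maxL as))

maxL≤⇒RowInsert-append : ∀ {y} r → maxL r ≤ y → RowInsert y r nothing (r ++ [ y ])
maxL≤⇒RowInsert-append [] _ = append
maxL≤⇒RowInsert-append (a ∷ as) r≤y =
  skip (≤-trans (m≤m⊔n a (maxL as)) r≤y) (maxL≤⇒RowInsert-append as (≤-trans (m≤n⊔m a (maxL as)) r≤y))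

big : ℕ → ℕ
big (suc (suc (suc _))) = 1
big _ = 0

countBig : List ℕ → ℕ
countBig [] = 0
countBig (a ∷ as) = big a + countBig as

big-≤2 : ∀ {z} → z ≤ 2 → big z ≡ 0
big-≤2 z≤n = refl
big-≤2 (s≤s z≤n) = refl
big-≤2 (s≤s (s≤s z≤n)) = refl

big->2 : ∀ {z} → 2 < z → big z ≡ 1
big->2 (s≤s (s≤s (s≤s _))) = refl

big≡0⇒≤2 : ∀ z → big z ≡ 0 → z ≤ 2
big≡0⇒≤2 0 _ = z≤n
big≡0⇒≤2 1 _ = s≤s z≤n
big≡0⇒≤2 2 _ = s≤s (s≤s z≤n)

countBig≡0⇒maxL≤2 : ∀ r → countBig r ≡ 0 → maxL r ≤ 2
countBig≡0⇒maxL≤2 [] _ = z≤n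
countBig≡0⇒maxL≤2 (a ∷ as) e =
  ⊔-lub (big≡0⇒≤2 a (m+n≡0⇒m≡0 (big a) e)) (countBig≡0⇒maxL≤2 as (m+n≡0⇒n≡0 (big a) e))

maxL≤2⇒countBig≡0 : ∀ r → maxL r ≤ 2 → countBig r ≡ 0
maxL≤2⇒countBig≡0 [] _ = refl
maxL≤2⇒countBig≡0 (a ∷ as) r≤2 =
  cong₂ _+_ (big-≤2 (≤-trans (m≤m⊔n a (maxL as)) r≤2))
            (maxL≤2⇒countBig≡0 as (≤-trans (m≤n⊔m a (maxL as)) r≤2))

RowInsert-countBig : ∀ {y r mz r′} → RowInsert y r mz r′ → countBig r′ + maybe′ big 0 mz ≡ big y + countBig r
RowInsert-countBig {y} append = +-identityʳ (big y + 0)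
RowInsert-countBig {y} (bump {a} {as} _) =
  trans (+-assoc (big y) (countBig as) (big a)) (x∙yz≈x∙zy (big y) (countBig as) (big a))
RowInsert-countBig {y} (skip {a} {as} {mz} {as′} _ h) = begin
  big a + countBig as′ + maybe′ big 0 mz   ≡⟨ +-assoc (big a) (countBig as′) _ ⟩
  big a + (countBig as′ + maybe′ big 0 mz) ≡⟨ cong (big a +_) (RowInsert-countBig h) ⟩
  big a + (big y + countBig as)            ≡⟨ x∙yz≈y∙xz (big a) (big y) (countBig as) ⟩
  big y + (big a + countBig as)            ∎
  where open ≡-Reasoning

RowInsert-countBig-≤ : ∀ {y r mz r′} → RowInsert y r mz r′ → y ≤ 2 → countBig r′ ≤ countBig r
RowInsert-countBig-≤ {y} {r} {mz} {r′} h y≤2 = begin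
  countBig r′                          ≤⟨ m≤m+n (countBig r′) _ ⟩
  countBig r′ + maybe′ big 0 mz        ≡⟨ RowInsert-countBig h ⟩
  big y + countBig r                   ≡⟨ cong (_+ countBig r) (big-≤2 y≤2) ⟩
  countBig r                           ∎
  where open ≤-Reasoning

RowInsert-2-countBig-< : ∀ {r mz r′} → RowInsert 2 r mz r′ → 0 < countBig r → countBig r′ < countBig r
RowInsert-2-countBig-< {r} {nothing} h big∈r
  with () ← subst (0 <_) (maxL≤2⇒countBig≡0 r (RowInsert-nothing⇒maxL≤ h)) big∈r
RowInsert-2-countBig-< {r} {just z} {r′} h _ = begin-strict
  countBig r′            <⟨ m<m+n (countBig r′) z<s ⟩
  countBig r′ + 1        ≡⟨ cong (countBig r′ +_) (sym (big->2 (RowInsert-bumped> h))) ⟩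
  countBig r′ + big z    ≡⟨ RowInsert-countBig h ⟩
  countBig r             ∎
  where open ≤-Reasoning

Rows₂ : Set
Rows₂ = List ℕ × List ℕ

Tableau₂ : Rows₂ → Set
Tableau₂ (r , s) = Sorted r × Sorted s × ColumnStrict r s

Tableau₂-tail : ∀ {a r b s} → Tableau₂ (a ∷ r , b ∷ s) → Tableau₂ (r , s)
Tableau₂-tail ((_ , r↑) , (_ , s↑) , (_ , st)) = r↑ , s↑ , st

carry : Maybe ℕ → List ℕ → List ℕ
carry nothing s = s
carry (just z) s = proj₂ (rowInsert z s)

rowInsert₂ : ℕ → Rows₂ → Rows₂
rowInsert₂ y (r , s) = proj₂ (rowInsert y r) , carry (proj₁ (rowInsert y r)) s

rowInserts₂ : List ℕ → Rows₂ → Rows₂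
rowInserts₂ u S = foldl (λ T y → rowInsert₂ y T) S u

-- Column insertion of c, restricted to the first two rows: it is faithful only when c does
-- not exceed the head of row 2, since otherwise the insertion path reaches row 3.
colInsert : ℕ → List ℕ → List ℕ → Rows₂
colInsert c [] s = [ c ] , s
colInsert c (a ∷ r) s with c ≤? a
... | yes _ = c ∷ a ∷ r , s
colInsert c (a ∷ r) [] | no _ = a ∷ r , [ c ]
colInsert c (a ∷ r) (b ∷ s) | no _ = a ∷ proj₁ (colInsert b r s) , c ∷ proj₂ (colInsert b r s)

colInsert₂ : ℕ → Rows₂ → Rows₂
colInsert₂ c (r , s) = colInsert c r s

colInserts₂ : List ℕ → Rows₂ → Rows₂
colInserts₂ u S = foldr colInsert₂ S u

consColumn : ℕ → ℕ → Rows₂ → Rows₂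
consColumn a c (r , s) = a ∷ r , c ∷ s

rowInsert₂-RowInsert : ∀ {y r mz r′} s → RowInsert y r mz r′ → rowInsert₂ y (r , s) ≡ (r′ , carry mz s)
rowInsert₂-RowInsert s h rewrite RowInsert⇒rowInsert h = refl

_≤ᵐ_ : ℕ → Maybe ℕ → Set
c ≤ᵐ nothing = ⊤
c ≤ᵐ just z = c ≤ z

≤ᵐ-trans : ∀ {c b} mz → c ≤ b → b ≤ᵐ mz → c ≤ᵐ mz
≤ᵐ-trans nothing _ _ = tt
≤ᵐ-trans (just _) c≤b b≤z = ≤-trans c≤b b≤z

carry-bump : ∀ {z c} s → z < c → carry (just z) (c ∷ s) ≡ z ∷ s
carry-bump s z<c = cong proj₂ (RowInsert⇒rowInsert (bump {as = s} z<c))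

carry-skip : ∀ {c} s mz → c ≤ᵐ mz → carry mz (c ∷ s) ≡ c ∷ carry mz s
carry-skip s nothing _ = refl
carry-skip s (just z) c≤z = cong proj₂ (RowInsert⇒rowInsert (skip c≤z (rowInsert-RowInsert z s)))

colInsert₂-prepend : ∀ {c} r s → c ≤head r → colInsert₂ c (r , s) ≡ (c ∷ r , s)
colInsert₂-prepend [] s _ = refl
colInsert₂-prepend {c} (a ∷ r) s c≤a with c ≤? a
... | yes _ = refl
... | no c≰a = contradiction c≤a c≰a

colInsert₂-below-end : ∀ {c a} r → a < c → colInsert₂ c (a ∷ r , []) ≡ (a ∷ r , [ c ])
colInsert₂-below-end {c} {a} r a<c with c ≤? a
... | yes c≤a = contradiction c≤a (<⇒≱ a<c)
... | no _ = refl

colInsert₂-below : ∀ {c a b} r s → a < c → colInsert₂ c (a ∷ r , b ∷ s) ≡ consColumn a c (colInsert₂ b (r , s))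
colInsert₂-below {c} {a} r s a<c with c ≤? a
... | yes c≤a = contradiction c≤a (<⇒≱ a<c)
... | no _ = refl

colInsert₂-keeps-bump : ∀ {y c z r r′} s → Sorted s → c ≤head s → RowInsert y r (just z) r′ → z < c →
  RowInsert y (proj₁ (colInsert₂ c (r , s))) (just z) (proj₁ (colInsert₂ c (r′ , s))) ×
  proj₂ (colInsert₂ c (r , s)) ≡ proj₂ (colInsert₂ c (r′ , s))
colInsert₂-keeps-bump [] _ _ (bump {as = as} y<a) a<c
  rewrite colInsert₂-below-end as a<c | colInsert₂-below-end as (<-trans y<a a<c) = bump y<a , refl
colInsert₂-keeps-bump (b ∷ s) _ _ (bump {as = as} y<a) a<c
  rewrite colInsert₂-below {b = b} as s a<c | colInsert₂-below {b = b} as s (<-trans y<a a<c) = bump y<a , refl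
colInsert₂-keeps-bump [] _ _ (skip {as = as} {as′ = as′} a≤y h) z<c
  with a<c ← <-trans (RowInsert-headBelow (skip a≤y h)) z<c
  rewrite colInsert₂-below-end as a<c | colInsert₂-below-end as′ a<c = skip a≤y h , refl
colInsert₂-keeps-bump (b ∷ s) (b≤s , s↑) c≤b (skip {as = as} {as′ = as′} a≤y h) z<c
  with a<c ← <-trans (RowInsert-headBelow (skip a≤y h)) z<c
     | h′ , row₂≡ ← colInsert₂-keeps-bump s s↑ b≤s h (<-≤-trans z<c c≤b)
  rewrite colInsert₂-below {b = b} as s a<c | colInsert₂-below {b = b} as′ s a<c = skip a≤y h′ , cong (_ ∷_) row₂≡

mutual
  colInsert₂-bump-bound : ∀ {y c mz r r′ mz′ R′} s → Sorted s → c ≤head s → RowInsert y r mz r′ → c ≤ᵐ mz →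
    RowInsert y (proj₁ (colInsert₂ c (r , s))) mz′ R′ → c ≤ᵐ mz′
  colInsert₂-bump-bound _ _ _ append _ (bump _) = ≤-refl
  colInsert₂-bump-bound _ _ _ append _ (skip _ append) = tt
  colInsert₂-bump-bound {c = c} s _ _ (bump {a} y<a) c≤a h′ with c ≤? a
  ... | no c≰a = contradiction c≤a c≰a
  ... | yes _ with h′
  ...   | bump _ = ≤-refl
  ...   | skip _ (bump _) = c≤a
  ...   | skip _ (skip a≤y _) = contradiction y<a (≤⇒≯ a≤y)
  colInsert₂-bump-bound {c = c} s _ _ (skip {a} a≤y h) c≤mz h′ with c ≤? a
  ... | yes c≤a = subst (c ≤ᵐ_) (sym (RowInsert-skip-bumped (≤-trans c≤a a≤y) (skip a≤y h) h′)) c≤mz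
  colInsert₂-bump-bound {c = c} [] _ _ (skip a≤y h) c≤mz h′ | no _ =
    subst (c ≤ᵐ_) (sym (RowInsert-skip-bumped a≤y h h′)) c≤mz
  colInsert₂-bump-bound (_ ∷ s) (b≤s , s↑) c≤b (skip a≤y h) c≤mz h′ | no _ =
    colInsert₂-bump-bound-deeper s s↑ b≤s c≤b h c≤mz (proj₂ (RowInsert-skip-inv a≤y h′))

  colInsert₂-bump-bound-deeper : ∀ {y b c mz r r′ mz′ R′} s → Sorted s → b ≤head s → c ≤ b →
    RowInsert y r mz r′ → c ≤ᵐ mz → RowInsert y (proj₁ (colInsert₂ b (r , s))) mz′ R′ → c ≤ᵐ mz′
  colInsert₂-bump-bound-deeper {mz = nothing} {mz′ = mz′} s s↑ b≤s c≤b h _ h′ =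
    ≤ᵐ-trans mz′ c≤b (colInsert₂-bump-bound s s↑ b≤s h tt h′)
  colInsert₂-bump-bound-deeper {b = b} {mz = just z} {mz′ = mz′} s s↑ b≤s c≤b h c≤z h′ with <-≤-connex z b
  ... | inj₁ z<b = subst (_ ≤ᵐ_) (RowInsert-bumped-unique (proj₁ (colInsert₂-keeps-bump s s↑ b≤s h z<b)) h′) c≤z
  ... | inj₂ b≤z = ≤ᵐ-trans mz′ c≤b (colInsert₂-bump-bound s s↑ b≤s h b≤z h′)

rowInsert₂-bump-below : ∀ {y r z r′ c} t → RowInsert y r (just z) r′ → z < c →
  rowInsert₂ y (r , c ∷ t) ≡ (r′ , z ∷ t)
rowInsert₂-bump-below t h z<c = trans (rowInsert₂-RowInsert (_ ∷ t) h) (cong (_ ,_) (carry-bump t z<c))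

rowInsert₂-colInsert₂-bumped< : ∀ {y c z r r′} s → Sorted s → c ≤head s → RowInsert y r (just z) r′ → z < c →
  rowInsert₂ y (colInsert₂ c (r , s)) ≡ colInsert₂ z (r′ , s)
rowInsert₂-colInsert₂-bumped< {y} {c} [] _ _ h@(bump {a} {as} y<a) a<c = begin
  rowInsert₂ y (colInsert₂ c (a ∷ as , []))  ≡⟨ cong (rowInsert₂ y) (colInsert₂-below-end as a<c) ⟩
  rowInsert₂ y (a ∷ as , [ c ])              ≡⟨ rowInsert₂-bump-below [] h a<c ⟩
  (y ∷ as , [ a ])                           ≡⟨ colInsert₂-below-end as y<a ⟨
  colInsert₂ a (y ∷ as , [])                 ∎
  where open ≡-Reasoning
rowInsert₂-colInsert₂-bumped< {y} {c} (b ∷ s) _ _ h@(bump {a} {as} y<a) a<c = begin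
  rowInsert₂ y (colInsert₂ c (a ∷ as , b ∷ s))  ≡⟨ cong (rowInsert₂ y) (colInsert₂-below as s a<c) ⟩
  rowInsert₂ y (consColumn a c X)               ≡⟨ rowInsert₂-bump-below (proj₂ X) (bump y<a) a<c ⟩
  consColumn y a X                              ≡⟨ colInsert₂-below as s y<a ⟨
  colInsert₂ a (y ∷ as , b ∷ s)                 ∎
  where
  open ≡-Reasoning
  X : Rows₂
  X = colInsert₂ b (as , s)
rowInsert₂-colInsert₂-bumped< {y} {c} {z} [] _ _ h@(skip {a} {as} {as′ = as′} a≤y h₀) z<c = begin
  rowInsert₂ y (colInsert₂ c (a ∷ as , []))  ≡⟨ cong (rowInsert₂ y) (colInsert₂-below-end as (<-trans a<z z<c)) ⟩
  rowInsert₂ y (a ∷ as , [ c ])              ≡⟨ rowInsert₂-bump-below [] h z<c ⟩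
  (a ∷ as′ , [ z ])                          ≡⟨ colInsert₂-below-end as′ a<z ⟨
  colInsert₂ z (a ∷ as′ , [])                ∎
  where
  open ≡-Reasoning
  a<z : a < z
  a<z = RowInsert-headBelow h
rowInsert₂-colInsert₂-bumped< {y} {c} {z} (b ∷ s) (b≤s , s↑) c≤b h@(skip {a} {as} {as′ = as′} a≤y h₀) z<c = begin
  rowInsert₂ y (colInsert₂ c (a ∷ as , b ∷ s))  ≡⟨ cong (rowInsert₂ y) (colInsert₂-below as s (<-trans a<z z<c)) ⟩
  rowInsert₂ y (consColumn a c X)               ≡⟨ rowInsert₂-bump-below (proj₂ X) (skip a≤y (proj₁ kept)) z<c ⟩
  (a ∷ proj₁ X′ , z ∷ proj₂ X)                  ≡⟨ cong (λ t → a ∷ proj₁ X′ , z ∷ t) (proj₂ kept) ⟩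
  consColumn a z X′                             ≡⟨ colInsert₂-below as′ s a<z ⟨
  colInsert₂ z (a ∷ as′ , b ∷ s)                ∎
  where
  open ≡-Reasoning
  a<z : a < z
  a<z = RowInsert-headBelow h
  X X′ : Rows₂
  X = colInsert₂ b (as , s)
  X′ = colInsert₂ b (as′ , s)
  kept : RowInsert y (proj₁ X) (just z) (proj₁ X′) × proj₂ X ≡ proj₂ X′
  kept = colInsert₂-keeps-bump s s↑ b≤s h₀ (<-≤-trans z<c c≤b)

rowInsert₂-consColumn : ∀ {y a c} X → a ≤ y → c ≤ᵐ proj₁ (rowInsert y (proj₁ X)) →
  rowInsert₂ y (consColumn a c X) ≡ consColumn a c (rowInsert₂ y X)
rowInsert₂-consColumn {y} (R , S) a≤y c≤bumped =
  trans (rowInsert₂-RowInsert (_ ∷ S) (skip a≤y (rowInsert-RowInsert y R))) (cong (_ ,_) (carry-skip S _ c≤bumped))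

colInsert₂-headBelow-end : ∀ {z} r → HeadBelow z r → colInsert₂ z (r , []) ≡ (r , [ z ])
colInsert₂-headBelow-end (a ∷ r) a<z = colInsert₂-below-end r a<z

rowInsert₂-colInsert₂-prepend : ∀ {y c r mz r′} s → RowInsert y r mz r′ → c ≤head r → c ≤ y →
  rowInsert₂ y (colInsert₂ c (r , s)) ≡ colInsert₂ c (r′ , carry mz s)
rowInsert₂-colInsert₂-prepend {y} {c} {r} {mz} {r′} s h c≤r c≤y = begin
  rowInsert₂ y (colInsert₂ c (r , s))  ≡⟨ cong (rowInsert₂ y) (colInsert₂-prepend r s c≤r) ⟩
  rowInsert₂ y (c ∷ r , s)             ≡⟨ rowInsert₂-RowInsert s (skip c≤y h) ⟩
  (c ∷ r′ , carry mz s)                ≡⟨ colInsert₂-prepend r′ (carry mz s) (RowInsert-≤head h c≤r c≤y) ⟨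
  colInsert₂ c (r′ , carry mz s)       ∎
  where open ≡-Reasoning

rowInsert₂-colInsert₂-bump-above : ∀ {y c a as} s → Tableau₂ (a ∷ as , s) → y < c → c ≤ a →
  rowInsert₂ y (colInsert₂ c (a ∷ as , s)) ≡ colInsert₂ c (y ∷ as , carry (just a) s)
rowInsert₂-colInsert₂-bump-above {y} {c} {a} {as} [] ((a≤as , _) , _) y<c c≤a = begin
  rowInsert₂ y (colInsert₂ c (a ∷ as , []))  ≡⟨ cong (rowInsert₂ y) (colInsert₂-prepend (a ∷ as) [] c≤a) ⟩
  rowInsert₂ y (c ∷ a ∷ as , [])             ≡⟨ rowInsert₂-RowInsert [] (bump y<c) ⟩
  consColumn y c (a ∷ as , [])               ≡⟨ cong (consColumn y c) (colInsert₂-prepend as [] a≤as) ⟨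
  consColumn y c (colInsert₂ a (as , []))    ≡⟨ colInsert₂-below as [] y<c ⟨
  colInsert₂ c (y ∷ as , [ a ])              ∎
  where open ≡-Reasoning
rowInsert₂-colInsert₂-bump-above {y} {c} {a} {as} (b ∷ s) ((a≤as , _) , _ , a<b , _) y<c c≤a = begin
  rowInsert₂ y (colInsert₂ c (a ∷ as , b ∷ s))    ≡⟨ cong (rowInsert₂ y) (colInsert₂-prepend (a ∷ as) (b ∷ s) c≤a) ⟩
  rowInsert₂ y (c ∷ a ∷ as , b ∷ s)               ≡⟨ rowInsert₂-bump-below s (bump y<c) (≤-<-trans c≤a a<b) ⟩
  consColumn y c (a ∷ as , s)                     ≡⟨ cong (consColumn y c) (colInsert₂-prepend as s a≤as) ⟨
  consColumn y c (colInsert₂ a (as , s))          ≡⟨ colInsert₂-below as s y<c ⟨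
  colInsert₂ c (y ∷ as , a ∷ s)                   ≡⟨ cong (λ t → colInsert₂ c (y ∷ as , t)) (carry-bump s a<b) ⟨
  colInsert₂ c (y ∷ as , carry (just a) (b ∷ s))  ∎
  where open ≡-Reasoning

mutual
  rowInsert₂-colInsert₂-comm : ∀ {y c r mz r′} s → Tableau₂ (r , s) → c ≤head s →
    RowInsert y r mz r′ → c ≤ᵐ mz →
    rowInsert₂ y (colInsert₂ c (r , s)) ≡ colInsert₂ c (r′ , carry mz s)
  rowInsert₂-colInsert₂-comm {y} {c} [] _ _ append _ with <-≤-connex y c
  ... | inj₁ y<c = trans (rowInsert₂-RowInsert [] (bump y<c)) (sym (colInsert₂-below-end [] y<c))
  ... | inj₂ c≤y = rowInsert₂-colInsert₂-prepend [] append tt c≤y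
  rowInsert₂-colInsert₂-comm (_ ∷ _) (_ , _ , ()) _ append _
  rowInsert₂-colInsert₂-comm {y} {c} s T _ h@(bump y<a) c≤a with <-≤-connex y c
  ... | inj₁ y<c = rowInsert₂-colInsert₂-bump-above s T y<c c≤a
  ... | inj₂ c≤y = rowInsert₂-colInsert₂-prepend s h c≤a c≤y
  rowInsert₂-colInsert₂-comm {y} {c} s T c≤s h@(skip {a} a≤y h₀) c≤mz with <-≤-connex a c
  ... | inj₁ a<c = rowInsert₂-colInsert₂-skip-below s T c≤s a≤y h₀ c≤mz a<c
  ... | inj₂ c≤a = rowInsert₂-colInsert₂-prepend s h c≤a (≤-trans c≤a a≤y)

  rowInsert₂-colInsert₂-skip-below : ∀ {y c a as mz as′} s → Tableau₂ (a ∷ as , s) → c ≤head s →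
    a ≤ y → RowInsert y as mz as′ → c ≤ᵐ mz → a < c →
    rowInsert₂ y (colInsert₂ c (a ∷ as , s)) ≡ colInsert₂ c (a ∷ as′ , carry mz s)
  rowInsert₂-colInsert₂-skip-below {y} {c} {a} {as} {nothing} {as′} [] _ _ a≤y h c≤mz a<c = begin
    rowInsert₂ y (colInsert₂ c (a ∷ as , []))  ≡⟨ cong (rowInsert₂ y) (colInsert₂-below-end as a<c) ⟩
    rowInsert₂ y (a ∷ as , [ c ])              ≡⟨ rowInsert₂-RowInsert [ c ] (skip a≤y h) ⟩
    (a ∷ as′ , [ c ])                          ≡⟨ colInsert₂-below-end as′ a<c ⟨
    colInsert₂ c (a ∷ as′ , [])                ∎
    where open ≡-Reasoning
  rowInsert₂-colInsert₂-skip-below {y} {c} {a} {as} {just z} {as′} [] _ _ a≤y h c≤z a<c = begin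
    rowInsert₂ y (colInsert₂ c (a ∷ as , []))  ≡⟨ cong (rowInsert₂ y) (colInsert₂-below-end as a<c) ⟩
    rowInsert₂ y (a ∷ as , [ c ])              ≡⟨ rowInsert₂-RowInsert [ c ] (skip a≤y h) ⟩
    (a ∷ as′ , carry (just z) [ c ])           ≡⟨ cong (a ∷ as′ ,_) (carry-skip [] (just z) c≤z) ⟩
    consColumn a c (as′ , [ z ])               ≡⟨ cong (consColumn a c) (colInsert₂-headBelow-end as′ (RowInsert-headBelow h)) ⟨
    consColumn a c (colInsert₂ z (as′ , []))   ≡⟨ colInsert₂-below as′ [] a<c ⟨
    colInsert₂ c (a ∷ as′ , [ z ])             ∎
    where open ≡-Reasoning
  rowInsert₂-colInsert₂-skip-below {y} {c} {a} {as} {mz} {as′} (b ∷ s) T@(_ , (b≤s , s↑) , _) c≤b a≤y h c≤mz a<c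
    with b′ , s′ , carry≡ , tail≡ ← rowInsert₂-colInsert₂-comm-deeper s (Tableau₂-tail T) b≤s h = begin
    rowInsert₂ y (colInsert₂ c (a ∷ as , b ∷ s))  ≡⟨ cong (rowInsert₂ y) (colInsert₂-below as s a<c) ⟩
    rowInsert₂ y (consColumn a c X)               ≡⟨ rowInsert₂-consColumn X a≤y c≤bumped ⟩
    consColumn a c (rowInsert₂ y X)               ≡⟨ cong (consColumn a c) tail≡ ⟩
    consColumn a c (colInsert₂ b′ (as′ , s′))     ≡⟨ colInsert₂-below as′ s′ a<c ⟨
    colInsert₂ c (a ∷ as′ , b′ ∷ s′)              ≡⟨ cong (λ t → colInsert₂ c (a ∷ as′ , t)) carry≡ ⟨
    colInsert₂ c (a ∷ as′ , carry mz (b ∷ s))     ∎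
    where
    open ≡-Reasoning
    X : Rows₂
    X = colInsert₂ b (as , s)
    c≤bumped : c ≤ᵐ proj₁ (rowInsert y (proj₁ X))
    c≤bumped = colInsert₂-bump-bound-deeper s s↑ b≤s c≤b h c≤mz (rowInsert-RowInsert y (proj₁ X))

  rowInsert₂-colInsert₂-comm-deeper : ∀ {y b r mz r′} s → Tableau₂ (r , s) → b ≤head s → RowInsert y r mz r′ →
    ∃₂ λ b′ s′ → carry mz (b ∷ s) ≡ b′ ∷ s′ ×
                 rowInsert₂ y (colInsert₂ b (r , s)) ≡ colInsert₂ b′ (r′ , s′)
  rowInsert₂-colInsert₂-comm-deeper {mz = nothing} s T b≤s h =
    _ , _ , refl , rowInsert₂-colInsert₂-comm s T b≤s h tt
  rowInsert₂-colInsert₂-comm-deeper {b = b} {mz = just z} s T@(_ , s↑ , _) b≤s h with <-≤-connex z b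
  ... | inj₁ z<b = _ , _ , carry-bump s z<b , rowInsert₂-colInsert₂-bumped< s s↑ b≤s h z<b
  ... | inj₂ b≤z = _ , _ , carry-skip s (just z) b≤z , rowInsert₂-colInsert₂-comm s T b≤s h b≤z

carry-sorted : ∀ mz {s} → Sorted s → Sorted (carry mz s)
carry-sorted nothing s↑ = s↑
carry-sorted (just z) {s} s↑ = RowInsert-sorted (rowInsert-RowInsert z s) s↑

RowInsert-columnStrict-carry : ∀ {y r mz r′} s → RowInsert y r mz r′ → Sorted s → ColumnStrict r s →
  ColumnStrict r′ (carry mz s)
RowInsert-columnStrict-carry [] append _ _ = tt
RowInsert-columnStrict-carry (_ ∷ _) append _ ()
RowInsert-columnStrict-carry [] (bump y<a) _ _ = y<a , tt
RowInsert-columnStrict-carry (_ ∷ s) (bump y<a) _ (a<b , st) rewrite carry-bump s a<b = y<a , st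
RowInsert-columnStrict-carry {mz = nothing} [] (skip _ _) _ _ = tt
RowInsert-columnStrict-carry {mz = just _} [] h@(skip _ _) _ _ = RowInsert-headBelow h , tt
RowInsert-columnStrict-carry {mz = nothing} (_ ∷ s) (skip _ h) _ (a<b , st) = a<b , RowInsert-columnStrict s h st
RowInsert-columnStrict-carry {mz = just z} (b ∷ s) h@(skip _ h₀) (_ , s↑) (a<b , st) with <-≤-connex z b
... | inj₁ z<b rewrite carry-bump s z<b = RowInsert-headBelow h , RowInsert-columnStrict s h₀ st
... | inj₂ b≤z rewrite carry-skip s (just z) b≤z = a<b , RowInsert-columnStrict-carry s h₀ s↑ st

PositiveTableau₂ : Rows₂ → Set
PositiveTableau₂ (r , s) = Tableau₂ (r , s) × 1 ≤head r

PositiveTableau₂-2≤head₂ : ∀ r s → PositiveTableau₂ (r , s) → 2 ≤head s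
PositiveTableau₂-2≤head₂ _ [] _ = tt
PositiveTableau₂-2≤head₂ (a ∷ _) (_ ∷ _) ((_ , _ , a<b , _) , 1≤a) = ≤-trans (s≤s 1≤a) a<b

rowInsert₂-positiveTableau : ∀ {y} S → 1 ≤ y → PositiveTableau₂ S → PositiveTableau₂ (rowInsert₂ y S)
rowInsert₂-positiveTableau {y} (r , s) 1≤y ((r↑ , s↑ , st) , 1≤r) =
  (RowInsert-sorted h r↑ , carry-sorted (proj₁ (rowInsert y r)) s↑ , RowInsert-columnStrict-carry s h s↑ st) ,
  RowInsert-≤head h 1≤r 1≤y
  where
  h : RowInsert y r (proj₁ (rowInsert y r)) (proj₂ (rowInsert y r))
  h = rowInsert-RowInsert y r

rowInserts₂-positiveTableau : ∀ u S → All (1 ≤_) u → PositiveTableau₂ S → PositiveTableau₂ (rowInserts₂ u S)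
rowInserts₂-positiveTableau [] S _ T = T
rowInserts₂-positiveTableau (y ∷ u) S (1≤y ∷ 1≤u) T =
  rowInserts₂-positiveTableau u (rowInsert₂ y S) 1≤u (rowInsert₂-positiveTableau S 1≤y T)

-- Positivity makes every bumped letter and the head of row 2 at least 2, which is what
-- the side conditions of the commutation lemma ask of x.
rowInsert₂-colInsert₂-comm-≤2 : ∀ {x y} S → x ≤ 2 → 1 ≤ y → PositiveTableau₂ S →
  rowInsert₂ y (colInsert₂ x S) ≡ colInsert₂ x (rowInsert₂ y S)
rowInsert₂-colInsert₂-comm-≤2 {x} {y} (r , s) x≤2 1≤y P@(T , _) =
  rowInsert₂-colInsert₂-comm s T (≤head-trans s x≤2 (PositiveTableau₂-2≤head₂ r s P)) h (x≤bumped h)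
  where
  h : RowInsert y r (proj₁ (rowInsert y r)) (proj₂ (rowInsert y r))
  h = rowInsert-RowInsert y r
  x≤bumped : ∀ {mz r′} → RowInsert y r mz r′ → x ≤ᵐ mz
  x≤bumped {nothing} _ = tt
  x≤bumped {just _} h = ≤-trans x≤2 (≤-trans (s≤s 1≤y) (RowInsert-bumped> h))

rowInserts₂-colInsert₂-comm-≤2 : ∀ {x} u S → x ≤ 2 → All (1 ≤_) u → PositiveTableau₂ S →
  rowInserts₂ u (colInsert₂ x S) ≡ colInsert₂ x (rowInserts₂ u S)
rowInserts₂-colInsert₂-comm-≤2 [] S _ _ _ = refl
rowInserts₂-colInsert₂-comm-≤2 {x} (y ∷ u) S x≤2 (1≤y ∷ 1≤u) T = begin
  rowInserts₂ u (rowInsert₂ y (colInsert₂ x S))  ≡⟨ cong (rowInserts₂ u) (rowInsert₂-colInsert₂-comm-≤2 S x≤2 1≤y T) ⟩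
  rowInserts₂ u (colInsert₂ x (rowInsert₂ y S))  ≡⟨ rowInserts₂-colInsert₂-comm-≤2 u (rowInsert₂ y S) x≤2 1≤u
                                                      (rowInsert₂-positiveTableau S 1≤y T) ⟩
  colInsert₂ x (rowInserts₂ u (rowInsert₂ y S))  ∎
  where open ≡-Reasoning

firstRows : Tableau → Rows₂
firstRows T = rowOf 1 T , rowOf 2 T

firstRow-insertT : ∀ y T → rowOf 1 (insertT y T) ≡ proj₂ (rowInsert y (rowOf 1 T))
firstRow-insertT y [] = refl
firstRow-insertT y (r ∷ T) with rowInsert y r
... | nothing , _ = refl
... | just _ , _ = refl

firstRows-insertT : ∀ y T → firstRows (insertT y T) ≡ rowInsert₂ y (firstRows T)
firstRows-insertT y [] = refl
firstRows-insertT y (r ∷ T) with rowInsert y r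
... | nothing , _ = refl
... | just z , _ = cong (_ ,_) (firstRow-insertT z T)

firstRows-foldl : ∀ v T → firstRows (foldl (λ T x → insertT x T) T v) ≡ rowInserts₂ v (firstRows T)
firstRows-foldl [] T = refl
firstRows-foldl (y ∷ v) T = trans (firstRows-foldl v (insertT y T)) (cong (rowInserts₂ v) (firstRows-insertT y T))

P₂ : Word → Rows₂
P₂ v = firstRows (P v)

P₂-positiveTableau : ∀ v → All (1 ≤_) v → PositiveTableau₂ (P₂ v)
P₂-positiveTableau v 1≤v =
  subst PositiveTableau₂ (sym (firstRows-foldl v [])) (rowInserts₂-positiveTableau v ([] , []) 1≤v ((tt , tt , tt) , tt))

P₂-cons : ∀ {x} v → x ≤ 2 → All (1 ≤_) v → P₂ (x ∷ v) ≡ colInsert₂ x (P₂ v)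
P₂-cons {x} v x≤2 1≤v = begin
  P₂ (x ∷ v)                                ≡⟨ firstRows-foldl v ([ x ] ∷ []) ⟩
  rowInserts₂ v (colInsert₂ x ([] , []))    ≡⟨ rowInserts₂-colInsert₂-comm-≤2 v ([] , []) x≤2 1≤v ((tt , tt , tt) , tt) ⟩
  colInsert₂ x (rowInserts₂ v ([] , []))    ≡⟨ cong (colInsert₂ x) (firstRows-foldl v []) ⟨
  colInsert₂ x (P₂ v)                       ∎
  where open ≡-Reasoning

P₂-++-colInserts₂ : ∀ u w → All (_≤ 2) u → All (1 ≤_) (u ++ w) → P₂ (u ++ w) ≡ colInserts₂ u (P₂ w)
P₂-++-colInserts₂ [] w _ _ = refl
P₂-++-colInserts₂ (x ∷ u) w (x≤2 ∷ u≤2) (_ ∷ 1≤uw) =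
  trans (P₂-cons (u ++ w) x≤2 1≤uw) (cong (colInsert₂ x) (P₂-++-colInserts₂ u w u≤2 1≤uw))

P₂-++-rowInserts₂ : ∀ w u → P₂ (w ++ u) ≡ rowInserts₂ u (P₂ w)
P₂-++-rowInserts₂ w u = trans (cong firstRows (foldl-++ (λ T x → insertT x T) [] w u)) (firstRows-foldl u (P w))

OneOrTwo : ℕ → Set
OneOrTwo a = a ≡ 1 ⊎ a ≡ 2

oneOrTwo⇒≤2 : ∀ {a} → OneOrTwo a → a ≤ 2
oneOrTwo⇒≤2 (inj₁ refl) = s≤s z≤n
oneOrTwo⇒≤2 (inj₂ refl) = s≤s (s≤s z≤n)

oneOrTwo⇒≥1 : ∀ {a} → OneOrTwo a → 1 ≤ a
oneOrTwo⇒≥1 (inj₁ refl) = s≤s z≤n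
oneOrTwo⇒≥1 (inj₂ refl) = s≤s z≤n

C⇒colInserts₂≡rowInserts₂ : ∀ u w → All OneOrTwo u → All (1 ≤_) w → C u w →
  colInserts₂ u (P₂ w) ≡ rowInserts₂ u (P₂ w)
C⇒colInserts₂≡rowInserts₂ u w u∈12 1≤w uw≡wu = begin
  colInserts₂ u (P₂ w)  ≡⟨ P₂-++-colInserts₂ u w (All.map oneOrTwo⇒≤2 u∈12) (++⁺ (All.map oneOrTwo⇒≥1 u∈12) 1≤w) ⟨
  P₂ (u ++ w)           ≡⟨ cong firstRows uw≡wu ⟩
  P₂ (w ++ u)           ≡⟨ P₂-++-rowInserts₂ w u ⟩
  rowInserts₂ u (P₂ w)  ∎
  where open ≡-Reasoning

countBig₁ : Rows₂ → ℕ
countBig₁ (r , _) = countBig r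

countBig₁₂ : Rows₂ → ℕ
countBig₁₂ (r , s) = countBig r + countBig s

colInsert₂-countBig₁-mono : ∀ c r s → countBig r ≤ countBig₁ (colInsert₂ c (r , s))
colInsert₂-countBig₁-mono c [] s = z≤n
colInsert₂-countBig₁-mono c (a ∷ r) s with c ≤? a
... | yes _ = m≤n+m _ (big c)
colInsert₂-countBig₁-mono c (a ∷ r) [] | no _ = ≤-refl
colInsert₂-countBig₁-mono c (a ∷ r) (b ∷ s) | no _ = +-monoʳ-≤ (big a) (colInsert₂-countBig₁-mono b r s)

colInsert₂-length₂-mono : ∀ c r s → length s ≤ length (proj₂ (colInsert₂ c (r , s)))
colInsert₂-length₂-mono c [] s = ≤-refl
colInsert₂-length₂-mono c (a ∷ r) s with c ≤? a
... | yes _ = ≤-refl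
colInsert₂-length₂-mono c (a ∷ r) [] | no _ = z≤n
colInsert₂-length₂-mono c (a ∷ r) (b ∷ s) | no _ = s≤s (colInsert₂-length₂-mono b r s)

colInsert₂-countBig₁₂ : ∀ c r s → countBig₁₂ (colInsert₂ c (r , s)) ≡ big c + countBig₁₂ (r , s)
colInsert₂-countBig₁₂ c [] s = +-assoc (big c) 0 (countBig s)
colInsert₂-countBig₁₂ c (a ∷ r) s with c ≤? a
... | yes _ = +-assoc (big c) (countBig (a ∷ r)) (countBig s)
colInsert₂-countBig₁₂ c (a ∷ r) [] | no _ = x∙yz≈y∙xz (countBig (a ∷ r)) (big c) 0
colInsert₂-countBig₁₂ c (a ∷ r) (b ∷ s) | no _ = begin
  (big a + countBig r′) + (big c + countBig s′)   ≡⟨ shuffle (big a) (big c) (countBig r′) (countBig s′) ⟩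
  big c + (big a + (countBig r′ + countBig s′))   ≡⟨ cong (λ n → big c + (big a + n)) (colInsert₂-countBig₁₂ b r s) ⟩
  big c + (big a + (big b + countBig₁₂ (r , s)))  ≡⟨ cong (big c +_) (regroup (big a) (big b) (countBig r) (countBig s)) ⟩
  big c + ((big a + countBig r) + (big b + countBig s)) ∎
  where
  open ≡-Reasoning
  r′ s′ : List ℕ
  r′ = proj₁ (colInsert₂ b (r , s))
  s′ = proj₂ (colInsert₂ b (r , s))
  shuffle : ∀ w x y z → (w + y) + (x + z) ≡ x + (w + (y + z))
  shuffle = solve-∀
  regroup : ∀ w x y z → w + (x + (y + z)) ≡ (w + y) + (x + z)
  regroup = solve-∀

colInserts₂-countBig₁-mono : ∀ u S → countBig₁ S ≤ countBig₁ (colInserts₂ u S)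
colInserts₂-countBig₁-mono [] S = ≤-refl
colInserts₂-countBig₁-mono (x ∷ u) S =
  ≤-trans (colInserts₂-countBig₁-mono u S)
          (colInsert₂-countBig₁-mono x (proj₁ (colInserts₂ u S)) (proj₂ (colInserts₂ u S)))

colInserts₂-length₂-mono : ∀ u S → length (proj₂ S) ≤ length (proj₂ (colInserts₂ u S))
colInserts₂-length₂-mono [] S = ≤-refl
colInserts₂-length₂-mono (x ∷ u) S =
  ≤-trans (colInserts₂-length₂-mono u S)
          (colInsert₂-length₂-mono x (proj₁ (colInserts₂ u S)) (proj₂ (colInserts₂ u S)))

colInserts₂-countBig₁₂ : ∀ u S → All (_≤ 2) u → countBig₁₂ (colInserts₂ u S) ≡ countBig₁₂ S
colInserts₂-countBig₁₂ [] S _ = refl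
colInserts₂-countBig₁₂ (x ∷ u) S (x≤2 ∷ u≤2) = begin
  countBig₁₂ (colInsert₂ x (colInserts₂ u S))  ≡⟨ colInsert₂-countBig₁₂ x (proj₁ (colInserts₂ u S)) (proj₂ (colInserts₂ u S)) ⟩
  big x + countBig₁₂ (colInserts₂ u S)         ≡⟨ cong₂ _+_ (big-≤2 x≤2) (colInserts₂-countBig₁₂ u S u≤2) ⟩
  countBig₁₂ S                                 ∎
  where open ≡-Reasoning

carry-countBig-≤ : ∀ mz s → countBig (carry mz s) ≤ maybe′ big 0 mz + countBig s
carry-countBig-≤ nothing s = ≤-refl
carry-countBig-≤ (just z) s = begin
  countBig s′                             ≤⟨ m≤m+n (countBig s′) _ ⟩
  countBig s′ + maybe′ big 0 (proj₁ (rowInsert z s)) ≡⟨ RowInsert-countBig (rowInsert-RowInsert z s) ⟩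
  big z + countBig s                      ∎
  where
  open ≤-Reasoning
  s′ : List ℕ
  s′ = proj₂ (rowInsert z s)

rowInsert₂-countBig₁-≤ : ∀ {x} S → x ≤ 2 → countBig₁ (rowInsert₂ x S) ≤ countBig₁ S
rowInsert₂-countBig₁-≤ {x} (r , _) x≤2 = RowInsert-countBig-≤ (rowInsert-RowInsert x r) x≤2

rowInsert₂-countBig₁₂-≤ : ∀ {x} S → x ≤ 2 → countBig₁₂ (rowInsert₂ x S) ≤ countBig₁₂ S
rowInsert₂-countBig₁₂-≤ {x} (r , s) x≤2 = begin
  countBig r′ + countBig (carry mz s)           ≤⟨ +-monoʳ-≤ (countBig r′) (carry-countBig-≤ mz s) ⟩
  countBig r′ + (maybe′ big 0 mz + countBig s)  ≡⟨ +-assoc (countBig r′) _ (countBig s) ⟨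
  countBig r′ + maybe′ big 0 mz + countBig s    ≡⟨ cong (_+ countBig s) (RowInsert-countBig (rowInsert-RowInsert x r)) ⟩
  big x + countBig r + countBig s               ≡⟨ cong (λ n → n + countBig r + countBig s) (big-≤2 x≤2) ⟩
  countBig r + countBig s                       ∎
  where
  open ≤-Reasoning
  mz : Maybe ℕ
  mz = proj₁ (rowInsert x r)
  r′ : List ℕ
  r′ = proj₂ (rowInsert x r)

rowInserts₂-countBig₁-≤ : ∀ u S → All (_≤ 2) u → countBig₁ (rowInserts₂ u S) ≤ countBig₁ S
rowInserts₂-countBig₁-≤ [] S _ = ≤-refl
rowInserts₂-countBig₁-≤ (x ∷ u) S (x≤2 ∷ u≤2) =
  ≤-trans (rowInserts₂-countBig₁-≤ u (rowInsert₂ x S) u≤2) (rowInsert₂-countBig₁-≤ S x≤2)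

rowInserts₂-countBig₁₂-≤ : ∀ u S → All (_≤ 2) u → countBig₁₂ (rowInserts₂ u S) ≤ countBig₁₂ S
rowInserts₂-countBig₁₂-≤ [] S _ = ≤-refl
rowInserts₂-countBig₁₂-≤ (x ∷ u) S (x≤2 ∷ u≤2) =
  ≤-trans (rowInserts₂-countBig₁₂-≤ u (rowInsert₂ x S) u≤2) (rowInsert₂-countBig₁₂-≤ S x≤2)

rowInserts₂-maxL₁≤2 : ∀ u S → All (_≤ 2) u → maxL (proj₁ S) ≤ 2 → maxL (proj₁ (rowInserts₂ u S)) ≤ 2
rowInserts₂-maxL₁≤2 [] S _ r≤2 = r≤2
rowInserts₂-maxL₁≤2 (x ∷ u) (r , s) (x≤2 ∷ u≤2) r≤2 =
  rowInserts₂-maxL₁≤2 u (rowInsert₂ x (r , s)) u≤2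
    (≤-trans (RowInsert-maxL (rowInsert-RowInsert x r)) (⊔-lub x≤2 r≤2))

rowInserts₂-countBig₁-< : ∀ u S → All OneOrTwo u → 1 ≤ m 2 u → 0 < countBig₁ S →
  countBig₁ (rowInserts₂ u S) < countBig₁ S
rowInserts₂-countBig₁-< (_ ∷ u) (r , s) (inj₂ refl ∷ u∈12) _ pos =
  ≤-<-trans (rowInserts₂-countBig₁-≤ u _ (All.map oneOrTwo⇒≤2 u∈12))
            (RowInsert-2-countBig-< (rowInsert-RowInsert 2 r) pos)
rowInserts₂-countBig₁-< (_ ∷ u) S (inj₁ refl ∷ u∈12) 2∈u pos with 0 <? countBig₁ (rowInsert₂ 1 S)
... | yes pos′ = <-≤-trans (rowInserts₂-countBig₁-< u _ u∈12 2∈u pos′) (rowInsert₂-countBig₁-≤ S (s≤s z≤n))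
... | no ¬pos′ =
  ≤-<-trans (≤-trans (rowInserts₂-countBig₁-≤ u _ (All.map oneOrTwo⇒≤2 u∈12)) (≮⇒≥ ¬pos′)) pos

rowInsert₂-1-countBig₁₂-< : ∀ r s → maxL r ≤ 2 → 1 < maxL r → 0 < countBig s →
  countBig₁₂ (rowInsert₂ 1 (r , s)) < countBig₁₂ (r , s)
rowInsert₂-1-countBig₁₂-< r s r≤2 1<r pos = go (rowInsert-RowInsert 1 r)
  where
  go : ∀ {mz r′} → RowInsert 1 r mz r′ → countBig r′ + countBig (carry mz s) < countBig r + countBig s
  go {nothing} h = contradiction (RowInsert-nothing⇒maxL≤ h) (<⇒≱ 1<r)
  go {just z} h with refl ← ≤-antisym (≤-trans (RowInsert-bumped≤maxL h) r≤2) (RowInsert-bumped> h) =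
    +-mono-≤-< (RowInsert-countBig-≤ h (s≤s z≤n)) (RowInsert-2-countBig-< (rowInsert-RowInsert 2 s) pos)

maxL-++-[_] : ∀ {x} r → maxL r ≤ x → maxL (r ++ [ x ]) ≡ x
maxL-++-[ r ] r≤x = ≤-antisym
  (≤-trans (RowInsert-maxL (maxL≤⇒RowInsert-append r r≤x)) (⊔-lub ≤-refl r≤x))
  (x≤maxL-++ r)
  where
  x≤maxL-++ : ∀ {x} r → x ≤ maxL (r ++ [ x ])
  x≤maxL-++ {x} [] = m≤m⊔n x 0
  x≤maxL-++ (a ∷ r) = ≤-trans (x≤maxL-++ r) (m≤n⊔m a _)

-- A 1 bumping a 2 out of row 1 would make that 2 bump an entry exceeding 2 out of row 2.
rowInserts₂-no-loss : ∀ u r s → All OneOrTwo u → maxL r ≤ 2 → 0 < countBig s →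
  countBig₁₂ (r , s) ≤ countBig₁₂ (rowInserts₂ u (r , s)) →
  Sorted (maxL r ∷ u) × rowInserts₂ u (r , s) ≡ (r ++ u , s)
rowInserts₂-no-loss [] r s _ _ _ _ = (tt , tt) , cong (_, s) (sym (++-identityʳ r))
rowInserts₂-no-loss (x ∷ u) r s (x∈12 ∷ u∈12) r≤2 pos no-loss with maxL r ≤? x | x∈12
... | no r≰x | inj₂ refl = contradiction r≤2 r≰x
... | no r≰x | inj₁ refl = contradiction no-loss (<⇒≱ (begin-strict
  countBig₁₂ (rowInserts₂ u (rowInsert₂ 1 (r , s)))  ≤⟨ rowInserts₂-countBig₁₂-≤ u _ (All.map oneOrTwo⇒≤2 u∈12) ⟩
  countBig₁₂ (rowInsert₂ 1 (r , s))                  <⟨ rowInsert₂-1-countBig₁₂-< r s r≤2 (≰⇒> r≰x) pos ⟩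
  countBig₁₂ (r , s)                                 ∎))
  where open ≤-Reasoning
... | yes r≤x | _ =
  (r≤x , subst (λ k → Sorted (k ∷ u)) (maxL-++-[ r ] r≤x) (proj₁ IH)) , (begin
    rowInserts₂ u (rowInsert₂ x (r , s))  ≡⟨ cong (rowInserts₂ u) append-x ⟩
    rowInserts₂ u (r ++ [ x ] , s)        ≡⟨ proj₂ IH ⟩
    ((r ++ [ x ]) ++ u , s)               ≡⟨ cong (_, s) (++-assoc r [ x ] u) ⟩
    (r ++ x ∷ u , s)                      ∎)
  where
  open ≡-Reasoning
  append-x : rowInsert₂ x (r , s) ≡ (r ++ [ x ] , s)
  append-x = rowInsert₂-RowInsert s (maxL≤⇒RowInsert-append r r≤x)
  r′≤2 : maxL (r ++ [ x ]) ≤ 2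
  r′≤2 = subst (_≤ 2) (sym (maxL-++-[ r ] r≤x)) (oneOrTwo⇒≤2 x∈12)
  no-loss′ : countBig₁₂ (r ++ [ x ] , s) ≤ countBig₁₂ (rowInserts₂ u (r ++ [ x ] , s))
  no-loss′ = subst (λ S → countBig₁₂ S ≤ countBig₁₂ (rowInserts₂ u S)) append-x
               (≤-trans (rowInsert₂-countBig₁₂-≤ (r , s) (oneOrTwo⇒≤2 x∈12)) no-loss)
  IH : Sorted (maxL (r ++ [ x ]) ∷ u) × rowInserts₂ u (r ++ [ x ] , s) ≡ ((r ++ [ x ]) ++ u , s)
  IH = rowInserts₂-no-loss u (r ++ [ x ]) s u∈12 r′≤2 pos no-loss′

Sorted-head≤ : ∀ {k a} u → Sorted (k ∷ u) → a ∈ u → k ≤ a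
Sorted-head≤ (_ ∷ _) (k≤x , _) (here refl) = k≤x
Sorted-head≤ (_ ∷ u) (k≤x , x↑u) (there a∈u) = ≤-trans k≤x (Sorted-head≤ u x↑u a∈u)

Sorted-max∈tail : ∀ {a x y u} → Sorted (x ∷ y ∷ u) → y ≤ a → a ∈ x ∷ y ∷ u → a ∈ y ∷ u
Sorted-max∈tail (x≤y , _) y≤a (here refl) = here (≤-antisym x≤y y≤a)
Sorted-max∈tail _ _ (there a∈yu) = a∈yu

Sorted-ends-with-max : ∀ {a} u → Sorted u → All (_≤ a) u → a ∈ u → ∃ λ u′ → u ≡ u′ ++ [ a ]
Sorted-ends-with-max (_ ∷ []) _ _ (here refl) = [] , refl
Sorted-ends-with-max (x ∷ y ∷ u) u↑@(_ , y↑u) (_ ∷ yu≤a@(y≤a ∷ _)) a∈u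
  with u′ , yu≡ ← Sorted-ends-with-max (y ∷ u) y↑u yu≤a (Sorted-max∈tail u↑ y≤a a∈u) =
  x ∷ u′ , cong (x ∷_) yu≡

m≥1⇒∈ : ∀ a u → 1 ≤ m a u → a ∈ u
m≥1⇒∈ a (x ∷ u) occurs with x ≟ a
... | yes refl = here refl
... | no x≢a = there (m≥1⇒∈ a u (subst (λ v → 1 ≤ length v) (filter-reject (_≟ a) x≢a) occurs))

Sorted-containing-1-2 : ∀ {k} u → Sorted (k ∷ u) → All (_≤ 2) u → 1 ≤ m 1 u → 1 ≤ m 2 u →
  k ≤ 1 × ∃ λ u′ → u ≡ u′ ++ [ 2 ]
Sorted-containing-1-2 u k↑u u≤2 1∈u 2∈u =
  Sorted-head≤ u k↑u (m≥1⇒∈ 1 u 1∈u) , Sorted-ends-with-max u (proj₂ k↑u) u≤2 (m≥1⇒∈ 2 u 2∈u)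

countBig>0⇒2<maxL : ∀ r → 0 < countBig r → 2 < maxL r
countBig>0⇒2<maxL r pos = ≰⇒> λ r≤2 → <⇒≢ pos (sym (maxL≤2⇒countBig≡0 r r≤2))

colInsert₂-past-row₁ : ∀ c r s → maxL r < c → Sorted (c ∷ s) → ColumnStrict r s → 2 < maxL (c ∷ s) →
  length s < length (proj₂ (colInsert₂ c (r , s))) ⊎ 0 < countBig₁ (colInsert₂ c (r , s))
colInsert₂-past-row₁ c [] [] _ _ _ 2<c⊔0 =
  inj₂ (subst (λ n → 0 < n + 0) (sym (big->2 (subst (2 <_) (⊔-identityʳ c) 2<c⊔0))) z<s)
colInsert₂-past-row₁ c (a ∷ r) s r<c _ _ _ with c ≤? a
... | yes c≤a = contradiction (≤-<-trans (≤-trans c≤a (m≤m⊔n a (maxL r))) r<c) (<-irrefl refl)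
colInsert₂-past-row₁ c (a ∷ r) [] _ _ _ _ | no _ = inj₁ ≤-refl
colInsert₂-past-row₁ c (a ∷ r) (b ∷ s) r<c (c≤b , b↑s) (_ , st) 2<max | no _
  with colInsert₂-past-row₁ b r s (<-≤-trans (≤-<-trans (m≤n⊔m a (maxL r)) r<c) c≤b) b↑s st
         (subst (2 <_) (m≤n⇒m⊔n≡n (≤-trans c≤b (m≤m⊔n b (maxL s)))) 2<max)
... | inj₁ longer = inj₁ (s≤s longer)
... | inj₂ pos = inj₂ (≤-trans pos (m≤n+m _ (big a)))

-- Column inserting 2 over a first row of 1s pushes 2 ∷ row 2 one column to the right: row 2
-- grows, or its largest entry (exceeding 2) lands in row 1.  Later column insertions undo neither.
colInserts₂-after-2-changes : ∀ u r s t → PositiveTableau₂ (r , s) → maxL r ≤ 1 → 0 < countBig s → maxL t ≤ 2 →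
  colInserts₂ u (colInsert₂ 2 (r , s)) ≢ (t , s)
colInserts₂-after-2-changes u r s t T@((_ , s↑ , st) , _) r≤1 pos t≤2 eq
  with colInsert₂-past-row₁ 2 r s (s≤s r≤1) (PositiveTableau₂-2≤head₂ r s T , s↑) st
         (<-≤-trans (countBig>0⇒2<maxL s pos) (m≤n⊔m 2 (maxL s)))
... | inj₁ longer = <-irrefl refl (begin-strict
  length s                                   <⟨ longer ⟩
  length (proj₂ (colInsert₂ 2 (r , s)))      ≤⟨ colInserts₂-length₂-mono u (colInsert₂ 2 (r , s)) ⟩
  length (proj₂ (colInserts₂ u (colInsert₂ 2 (r , s))))  ≡⟨ cong (length ∘ proj₂) eq ⟩
  length s                                   ∎)
  where open ≤-Reasoning
... | inj₂ pos₁ = <-irrefl refl (begin-strict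
  0                                          <⟨ pos₁ ⟩
  countBig₁ (colInsert₂ 2 (r , s))           ≤⟨ colInserts₂-countBig₁-mono u (colInsert₂ 2 (r , s)) ⟩
  countBig₁ (colInserts₂ u (colInsert₂ 2 (r , s)))  ≡⟨ cong countBig₁ eq ⟩
  countBig t                                 ≡⟨ maxL≤2⇒countBig≡0 t t≤2 ⟩
  0                                          ∎)
  where open ≤-Reasoning

P₂-row₁-≤2 : ∀ u w → All OneOrTwo u → 1 ≤ m 2 u → All (1 ≤_) w → C u w → maxL (proj₁ (P₂ w)) ≤ 2
P₂-row₁-≤2 u w u∈12 2∈u 1≤w uw≡wu = countBig≡0⇒maxL≤2 (proj₁ S) (n≤0⇒n≡0 (≮⇒≥ no-big))
  where
  S : Rows₂
  S = P₂ w
  no-big : ¬ 0 < countBig₁ S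
  no-big pos = <⇒≱ (rowInserts₂-countBig₁-< u S u∈12 2∈u pos) (begin
    countBig₁ S                  ≤⟨ colInserts₂-countBig₁-mono u S ⟩
    countBig₁ (colInserts₂ u S)  ≡⟨ cong countBig₁ (C⇒colInserts₂≡rowInserts₂ u w u∈12 1≤w uw≡wu) ⟩
    countBig₁ (rowInserts₂ u S)  ∎)
    where open ≤-Reasoning

P₂-row₂-≤2 : ∀ u w → All OneOrTwo u → 1 ≤ m 1 u → 1 ≤ m 2 u → All (1 ≤_) w → C u w →
  maxL (proj₂ (P₂ w)) ≤ 2
P₂-row₂-≤2 u w u∈12 1∈u 2∈u 1≤w uw≡wu = countBig≡0⇒maxL≤2 s (n≤0⇒n≡0 (≮⇒≥ no-big))
  where
  r s : List ℕ
  r = proj₁ (P₂ w)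
  s = proj₂ (P₂ w)
  u≤2 : All (_≤ 2) u
  u≤2 = All.map oneOrTwo⇒≤2 u∈12
  r≤2 : maxL r ≤ 2
  r≤2 = P₂-row₁-≤2 u w u∈12 2∈u 1≤w uw≡wu
  col≡row : colInserts₂ u (r , s) ≡ rowInserts₂ u (r , s)
  col≡row = C⇒colInserts₂≡rowInserts₂ u w u∈12 1≤w uw≡wu
  no-big : ¬ 0 < countBig s
  no-big pos = colInserts₂-after-2-changes u′ r s (r ++ u) (P₂-positiveTableau w 1≤w) r≤1 pos
                 (subst (λ S → maxL (proj₁ S) ≤ 2) appended (rowInserts₂-maxL₁≤2 u (r , s) u≤2 r≤2)) (begin
    colInserts₂ u′ (colInsert₂ 2 (r , s))  ≡⟨ foldr-++ colInsert₂ (r , s) u′ [ 2 ] ⟨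
    colInserts₂ (u′ ++ [ 2 ]) (r , s)      ≡⟨ cong (λ v → colInserts₂ v (r , s)) u≡ ⟨
    colInserts₂ u (r , s)                  ≡⟨ col≡row ⟩
    rowInserts₂ u (r , s)                  ≡⟨ appended ⟩
    (r ++ u , s)                           ∎)
    where
    open ≡-Reasoning
    no-loss : countBig₁₂ (r , s) ≤ countBig₁₂ (rowInserts₂ u (r , s))
    no-loss = ≤-reflexive (trans (sym (colInserts₂-countBig₁₂ u (r , s) u≤2)) (cong countBig₁₂ col≡row))
    appended-sorted : Sorted (maxL r ∷ u) × rowInserts₂ u (r , s) ≡ (r ++ u , s)
    appended-sorted = rowInserts₂-no-loss u r s u∈12 r≤2 pos no-loss
    appended : rowInserts₂ u (r , s) ≡ (r ++ u , s)
    appended = proj₂ appended-sorted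
    shape : maxL r ≤ 1 × ∃ λ u′ → u ≡ u′ ++ [ 2 ]
    shape = Sorted-containing-1-2 u (proj₁ appended-sorted) u≤2 1∈u 2∈u
    r≤1 : maxL r ≤ 1
    r≤1 = proj₁ shape
    u′ : List ℕ
    u′ = proj₁ (proj₂ shape)
    u≡ : u ≡ u′ ++ [ 2 ]
    u≡ = proj₂ (proj₂ shape)

lemma2p6 : (n : ℕ) (u w : Word) → length u ≡ n → All (λ a → a ≡ 1 ⊎ a ≡ 2) u → 1 ≤ m 1 u → 1 ≤ m 2 u → All (λ a → 1 ≤ a) w → C u w → (i : ℕ) → 1 ≤ i → i ≤ 2 → maxL (R i w) ≤ 2
lemma2p6 _ _ _ _ _ _ _ _ _ 0 () _
lemma2p6 _ u w _ u∈12 _ 2∈u 1≤w uw≡wu 1 _ _ = P₂-row₁-≤2 u w u∈12 2∈u 1≤w uw≡wu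
lemma2p6 _ u w _ u∈12 1∈u 2∈u 1≤w uw≡wu 2 _ _ = P₂-row₂-≤2 u w u∈12 1∈u 2∈u 1≤w uw≡wu
lemma2p6 _ _ _ _ _ _ _ _ _ (suc (suc (suc _))) _ (s≤s (s≤s ()))
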